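{- For all formulas $\phi,\psi$ of $\mathsf{JRC}$: if $\vDash_{\mathsf{JRC}}\phi\rightsquigarrow\psi$, then $\phi$ and $\psi$ have at least one atomic proposition in common.
   Context: Language of $\mathsf{JRC}$: countable sets $\mathsf{Var}$ (justification variables) and $\mathsf{Prop}$ (atomic propositions); terms $t ::= x \mid t+t$ ($x\in\mathsf{Var}$); formulas $\phi ::= p \mid {\sim}\phi \mid \phi\wedge\phi \mid \phi\rightarrow\phi \mid \phi\rightsquigarrow\phi \mid t{:}\phi$. A Routley relational model is $\mathcal M=(W,W_N,R,R_{Fm},R_{Tm},{*},\mathcal V)$ where $W$ is a nonempty set, $\emptyset\ne W_N\subseteq W$ (normal states); $R\subseteq W\times W\times W$ satisfies: for $w\in W_N$, $Rwvu$ iff $v=u$; $R_{Fm}$ assigns to each formula $\phi$ a relation $R_\phi\subseteq W\times W$; $R_{Tm}$ assigns to each term $t$ a relation $R_t\subseteq W\times W$; ${*}:W\to W$ with $w^{**}=w$; $\mathcal V:\mathsf{Prop}\to\mathcal P(W)$. $R_\phi(w)=\{v:wR_\phi v\}$, $R_t(w)=\{v:wR_tv\}$, $[\![\phi]\!]=\{w\in W:(\mathcal M,w)\vDash\phi\}$. Truth at every $w\in W$: $p$ iff $w\in\mathcal V(p)$; ${\sim}\phi$ iff $(\mathcal M,w^*)\nvDash\phi$; $\phi\wedge\psi$ iff both; $\phi\rightarrow\psi$ iff for all $v,u$ with $Rwvu$, $v\vDash\phi$ implies $u\vDash\psi$; $\phi\rightsquigarrow\psi$ iff for all $v$ with $wR_\phi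 v$, $v\vDash\psi$; $t{:}\phi$ iff for all $v$ with $wR_tv$, $v\vDash\phi$. A $\mathsf{JRC}$-model is one satisfying: (1) for $w\in W_N$, $R_\phi(w)\subseteq[\![\phi]\!]$; (2) for all $w\in W$, $w\in[\![\phi]\!]$ implies $w\in R_\phi(w)$; (3) $R_{s+t}\subseteq R_s\cap R_t$ for all terms $s,t$. $\vDash_{\mathsf{JRC}}\phi$ means $\phi$ is true at every normal state of every $\mathsf{JRC}$-model. -}

module Defs where

open import Data.Nat using (ℕ)
open import Data.Product using (Σ; _×_; ∃-syntax)
open import Data.Empty using (⊥)
open import Data.Sum using (_⊎_)
open import Relation.Binary.PropositionalEquality using (_≡_)
open import Relation.Nullary using (¬_)
open import Level using (suc; zero)

Var : Set
Var = ℕ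

Prop : Set
Prop = ℕ

infixl 6 _⊕_
data Term : Set where
  var : Var → Term
  _⊕_ : Term → Term → Term

infixr 4 _⇒_ _⇝_
infixr 5 _∧_
data Fm : Set where
  atom : Prop → Fm
  ∼_   : Fm → Fm
  _∧_  : Fm → Fm → Fm
  _⇒_  : Fm → Fm → Fm
  _⇝_  : Fm → Fm → Fm
  _∶_  : Term → Fm → Fm

record Model : Set₁ where
  field
    W      : Set
    WN     : W → Set
    WN-ne  : ∃[ w ] WN w
    R      : W → W → W → Set
    R-norm : ∀ {w} → WN w → ∀ v u → (R w v u → v ≡ u) × (v ≡ u → R w v u)
    RFm    : Fm → W → W → Set
    RTm    : Term → W → W → Set
    star   : W → W
    star-inv : ∀ w → star (star w) ≡ w
    V      : Prop → W → Set

_,_⊨_ : (M : Model) → Model.W M → Fm → Set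
M , w ⊨ atom p  = Model.V M p w
M , w ⊨ (∼ φ)   = ¬ (M , Model.star M w ⊨ φ)
M , w ⊨ (φ ∧ ψ) = (M , w ⊨ φ) × (M , w ⊨ ψ)
M , w ⊨ (φ ⇒ ψ) = ∀ v u → Model.R M w v u → M , v ⊨ φ → M , u ⊨ ψ
M , w ⊨ (φ ⇝ ψ) = ∀ v → Model.RFm M φ w v → M , v ⊨ ψ
M , w ⊨ (t ∶ φ) = ∀ v → Model.RTm M t w v → M , v ⊨ φ

record IsJRC (M : Model) : Set where
  open Model M
  field
    cond1 : ∀ φ w v → WN w → RFm φ w v → M , v ⊨ φ
    cond2 : ∀ φ w → M , w ⊨ φ → RFm φ w w
    cond3 : ∀ s t w v → RTm (s ⊕ t) w v → RTm s w v × RTm t w v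

⊨JRC : Fm → Set₁
⊨JRC φ = (M : Model) → IsJRC M → ∀ w → Model.WN M w → M , w ⊨ φ

data _occursIn_ (p : Prop) : Fm → Set where
  here  : p occursIn atom p
  in∼   : ∀ {φ} → p occursIn φ → p occursIn (∼ φ)
  in∧ˡ  : ∀ {φ ψ} → p occursIn φ → p occursIn (φ ∧ ψ)
  in∧ʳ  : ∀ {φ ψ} → p occursIn ψ → p occursIn (φ ∧ ψ)
  in⇒ˡ  : ∀ {φ ψ} → p occursIn φ → p occursIn (φ ⇒ ψ)
  in⇒ʳ  : ∀ {φ ψ} → p occursIn ψ → p occursIn (φ ⇒ ψ)
  in⇝ˡ  : ∀ {φ ψ} → p occursIn φ → p occursIn (φ ⇝ ψ)
  in⇝ʳ  : ∀ {φ ψ} → p occursIn ψ → p occursIn (φ ⇝ ψ)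
  in∶   : ∀ {t φ} → p occursIn φ → p occursIn (t ∶ φ)

module Submission where

open import Defs
open import Data.Empty using (⊥; ⊥-elim)
open import Data.Nat using (_≟_)
open import Data.Product using (_×_; _,_; ∃-syntax; proj₁; proj₂; map₁; map₂)
open import Data.Sum using (_⊎_; inj₁; inj₂; [_,_])
open import Function using (id)
open import Level using (0ℓ)
open import Function.Bundles using (_⇔_; mk⇔; Equivalence)
open import Relation.Binary.PropositionalEquality using (_≡_; refl; sym; cong; subst)
open import Relation.Nullary using (¬_; yes; no)
open import Relation.Nullary.Decidable using (map′; _⊎-dec_)
open import Relation.Unary using (Pred)
import Relation.Binary.Definitions as Binary
import Relation.Unary as Unary

-- Let S be the set of atoms of φ. In a model with a normal state n (n* = n) and two
-- non-normal states a, b swapped by *, make p true at a iff p ∈ S and at b iff p ∉ S.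
-- Choosing R at a and b so that every connective preserves this, a formula whose atoms
-- are all in S is true at a and false at b, and a formula whose atoms all avoid S is
-- false at a and true at b. Letting R_χ(n) be the states among n and a satisfying χ
-- gives a JRC-model, and φ is true at a, so validity of φ ⇝ ψ makes ψ true at a too:
-- ψ cannot avoid every atom of φ.

SomeAtom : Pred Prop 0ℓ → Pred Fm _
SomeAtom P χ = ∃[ p ] p occursIn χ × P p

AllAtoms : Pred Prop 0ℓ → Pred Fm _
AllAtoms P χ = ∀ p → p occursIn χ → P p

someAtom? : {P : Pred Prop 0ℓ} → Unary.Decidable P → Unary.Decidable (SomeAtom P)
someAtom? P? (atom q) = map′ (λ Pq → q , here , Pq) (λ { (_ , here , Pq) → Pq }) (P? q)
someAtom? P? (∼ χ) =
  map′ (map₂ (map₁ in∼)) (λ { (p , in∼ o , Pp) → p , o , Pp }) (someAtom? P? χ)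
someAtom? P? (χ ∧ χ′) =
  map′ [ map₂ (map₁ in∧ˡ) , map₂ (map₁ in∧ʳ) ]
       (λ { (p , in∧ˡ o , Pp) → inj₁ (p , o , Pp) ; (p , in∧ʳ o , Pp) → inj₂ (p , o , Pp) })
       (someAtom? P? χ ⊎-dec someAtom? P? χ′)
someAtom? P? (χ ⇒ χ′) =
  map′ [ map₂ (map₁ in⇒ˡ) , map₂ (map₁ in⇒ʳ) ]
       (λ { (p , in⇒ˡ o , Pp) → inj₁ (p , o , Pp) ; (p , in⇒ʳ o , Pp) → inj₂ (p , o , Pp) })
       (someAtom? P? χ ⊎-dec someAtom? P? χ′)
someAtom? P? (χ ⇝ χ′) =
  map′ [ map₂ (map₁ in⇝ˡ) , map₂ (map₁ in⇝ʳ) ]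
       (λ { (p , in⇝ˡ o , Pp) → inj₁ (p , o , Pp) ; (p , in⇝ʳ o , Pp) → inj₂ (p , o , Pp) })
       (someAtom? P? χ ⊎-dec someAtom? P? χ′)
someAtom? P? (t ∶ χ) =
  map′ (map₂ (map₁ in∶)) (λ { (p , in∶ o , Pp) → p , o , Pp }) (someAtom? P? χ)

_occursIn?_ : Binary.Decidable _occursIn_
p occursIn? χ = map′ (λ { (_ , o , refl) → o }) (λ o → p , o , refl) (someAtom? (_≟ p) χ)

data Side : Set where
  pos neg : Side

opposite : Side → Side
opposite pos = neg
opposite neg = pos

opposite-involutive : ∀ s → opposite (opposite s) ≡ s
opposite-involutive pos = refl
opposite-involutive neg = refl

data State : Set where
  normal : State
  side   : Side → State

module Separating (S : Pred Prop 0ℓ) where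

  open Equivalence using (to; from)

  val : Prop → State → Set
  val p normal     = ⊥
  val p (side pos) = S p
  val p (side neg) = ¬ S p

  star : State → State
  star normal   = normal
  star (side s) = side (opposite s)

  star-involutive : ∀ w → star (star w) ≡ w
  star-involutive normal   = refl
  star-involutive (side s) = cong side (opposite-involutive s)

  R : State → State → State → Set
  R normal   v u = v ≡ u
  R (side s) v u = v ≡ side (opposite s) × u ≡ side s

  -- R_χ(normal) is defined from the truth of χ, which only involves R at proper
  -- subformulas; so truth is defined directly, together with RFm, by recursion on χ,
  -- and identified with ⊨ in the resulting model afterwards.
  mutual
    Holds : Fm → State → Set
    Holds (atom p) w = val p w
    Holds (∼ χ)    w = ¬ Holds χ (star w)
    Holds (χ ∧ χ′) w = Holds χ w × Holds χ′ w
    Holds (χ ⇒ χ′) w = ∀ v u → R w v u → Holds χ v → Holds χ′ u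
    Holds (χ ⇝ χ′) w = ∀ v → RFm χ w v → Holds χ′ v
    Holds (t ∶ χ)  w = ∀ v → v ≡ w → Holds χ v

    RFm : Fm → State → State → Set
    RFm χ normal   v = (v ≡ normal × Holds χ normal) ⊎ (v ≡ side pos × Holds χ (side pos))
    RFm χ (side s) v = v ≡ side s

  model : Model
  model = record
    { W = State ; WN = _≡ normal ; WN-ne = normal , refl
    ; R = R ; R-norm = λ { refl _ _ → id , id }
    ; RFm = RFm ; RTm = λ _ w v → v ≡ w
    ; star = star ; star-inv = star-involutive ; V = val }

  ⊨⇔Holds : ∀ χ w → (model , w ⊨ χ) ⇔ Holds χ w
  ⊨⇔Holds (atom p) w = mk⇔ id id
  ⊨⇔Holds (∼ χ)    w = mk⇔ (λ h x → h (from (⊨⇔Holds χ (star w)) x))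
                           (λ h x → h (to (⊨⇔Holds χ (star w)) x))
  ⊨⇔Holds (χ ∧ χ′) w = mk⇔ (λ (x , y) → to (⊨⇔Holds χ w) x , to (⊨⇔Holds χ′ w) y)
                           (λ (x , y) → from (⊨⇔Holds χ w) x , from (⊨⇔Holds χ′ w) y)
  ⊨⇔Holds (χ ⇒ χ′) w = mk⇔ (λ h v u r x → to (⊨⇔Holds χ′ u) (h v u r (from (⊨⇔Holds χ v) x)))
                           (λ h v u r x → from (⊨⇔Holds χ′ u) (h v u r (to (⊨⇔Holds χ v) x)))
  ⊨⇔Holds (χ ⇝ χ′) w = mk⇔ (λ h v r → to (⊨⇔Holds χ′ v) (h v r))
                           (λ h v r → from (⊨⇔Holds χ′ v) (h v r))
  ⊨⇔Holds (t ∶ χ)  w = mk⇔ (λ h v r → to (⊨⇔Holds χ v) (h v r))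
                           (λ h v r → from (⊨⇔Holds χ v) (h v r))

  isJRC : IsJRC model
  isJRC = record
    { cond1 = λ { χ _ _ refl (inj₁ (refl , h)) → from (⊨⇔Holds χ normal) h
                ; χ _ _ refl (inj₂ (refl , h)) → from (⊨⇔Holds χ (side pos)) h }
    ; cond2 = λ { χ normal h → inj₁ (refl , to (⊨⇔Holds χ normal) h)
                ; χ (side s) h → refl }
    ; cond3 = λ _ _ _ _ r → r , r }

  val-side-exclusive : ∀ s p → val p (side s) → ¬ val p (side (opposite s))
  val-side-exclusive pos p Sp ¬Sp = ¬Sp Sp
  val-side-exclusive neg p ¬Sp Sp = ¬Sp Sp

  separates : ∀ s χ → AllAtoms (λ p → val p (side s)) χ →
              Holds χ (side s) × ¬ Holds χ (side (opposite s))
  separates s (atom p) all = all p here , val-side-exclusive s p (all p here)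
  separates s (∼ χ) all with separates s χ (λ p o → all p (in∼ o))
  ... | h , ¬h = ¬h , λ k → k (subst (λ s′ → Holds χ (side s′)) (sym (opposite-involutive s)) h)
  separates s (χ ∧ χ′) all with separates s χ (λ p o → all p (in∧ˡ o))
                              | separates s χ′ (λ p o → all p (in∧ʳ o))
  ... | h , ¬h | h′ , _ = (h , h′) , λ (k , _) → ¬h k
  separates s (χ ⇒ χ′) all with separates s χ (λ p o → all p (in⇒ˡ o))
                              | separates s χ′ (λ p o → all p (in⇒ʳ o))
  ... | h , ¬h | _ , ¬h′ =
    (λ { _ _ (refl , refl) k → ⊥-elim (¬h k) }) ,
    λ k → ¬h′ (k (side s) (side (opposite s)) (cong side (sym (opposite-involutive s)) , refl) h)
  separates s (χ ⇝ χ′) all with separates s χ′ (λ p o → all p (in⇝ʳ o))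
  ... | h′ , ¬h′ = (λ { _ refl → h′ }) , λ k → ¬h′ (k (side (opposite s)) refl)
  separates s (t ∶ χ) all with separates s χ (λ p o → all p (in∶ o))
  ... | h , ¬h = (λ { _ refl → h }) , λ k → ¬h (k (side (opposite s)) refl)

theorem7 : (φ ψ : Fm) → ⊨JRC (φ ⇝ ψ) → ∃[ p ] (p occursIn φ × p occursIn ψ)
theorem7 φ ψ valid with someAtom? (_occursIn? ψ) φ
... | yes common = common
... | no disjoint = ⊥-elim (ψ-false-at-pos ψ-true-at-pos)
  where
    open Separating (_occursIn φ)
    φ-true-at-pos : Holds φ (side pos)
    φ-true-at-pos = proj₁ (separates pos φ (λ _ o → o))
    ψ-false-at-pos : ¬ Holds ψ (side pos)
    ψ-false-at-pos = proj₂ (separates neg ψ (λ p o o′ → disjoint (p , o′ , o)))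
    ψ-true-at-pos : Holds ψ (side pos)
    ψ-true-at-pos = Equivalence.to (⊨⇔Holds ψ (side pos))
                                     (valid model isJRC normal refl (side pos) (inj₂ (refl , φ-true-at-pos)))
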